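{- Let $S_1$ be a set and $(S_2,\bullet)$ a partial semigroup. If $(Q,\le,\bullet)$ is a quantale (respectively a distributive quantale), then so is $(Q^{S_1\times S_2},\le,\bullet)$. If $S_2$ is a partial monoid and $Q$ is unital, then $Q^{S_1\times S_2}$ is unital with unit $\mathbb{1}_\bullet$; if $S_2$ and $Q$ are commutative, then $Q^{S_1\times S_2}$ is commutative.
   Context: A partial semigroup has an associative partial operation (undefined products denoted $\bot\notin S_2$); a partial monoid additionally has a unit $1_\bullet$. A quantale is a complete lattice with an associative multiplication distributing over arbitrary suprema on both sides; distributive if binary meets distribute over arbitrary joins and binary joins over arbitrary meets. On $Q^{S_1\times S_2}$ (curried, $F\,x\,y$): order, suprema and infima are pointwise, and $(F\bullet G)\,x\,y=\sum_{y=y_1\bullet y_2}F\,x\,y_1\bullet G\,x\,y_2$, the supremum over $y_1,y_2\in S_2$ with $y_1\bullet y_2$ defined and equal to $y$. The unit is $\mathbb{1}_\bullet\,x\,y=1_\bullet$ if $y=1_\bullet$ and $0$ otherwise. -}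

module Defs where

open import Level using (Level; _⊔_; suc)
open import Data.Product using (Σ; _×_; _,_)
open import Data.Maybe using (Maybe; just; _>>=_)
open import Relation.Binary.Core using (Rel)
open import Relation.Binary.PropositionalEquality using (_≡_)
open import Relation.Binary.Lattice.Structures using (IsLattice)

-- Partial semigroups / partial monoids.
-- The partial operation is  S → S → Maybe S  (nothing = undefined, ⊥).
-- Associativity: (x•y)•z is defined iff x•(y•z) is, and then they agree.

record IsPartialSemigroup {s} (S : Set s) (_•_ : S → S → Maybe S) : Set s where
  field
    assoc : ∀ x y z → ((x • y) >>= λ w → w • z) ≡ ((y • z) >>= λ w → x • w)

record IsPartialMonoid {s} (S : Set s) (_•_ : S → S → Maybe S) (e : S) : Set s where
  field
    isPartialSemigroup : IsPartialSemigroup S _•_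
    identityˡ : ∀ x → e • x ≡ just x
    identityʳ : ∀ x → x • e ≡ just x

PartialCommutative : ∀ {s} (S : Set s) (_•_ : S → S → Maybe S) → Set s
PartialCommutative S _•_ = ∀ x y → x • y ≡ y • x

record IsQuantale {c ℓ₁ ℓ₂} (ι : Level) (A : Set c)
  (_≈_ : Rel A ℓ₁) (_≤_ : Rel A ℓ₂)
  (⋁ ⋀ : {I : Set ι} → (I → A) → A)
  (_∨_ _∧_ _∙_ : A → A → A) : Set (suc ι ⊔ c ⊔ ℓ₁ ⊔ ℓ₂) where
  field
    isLattice : IsLattice _≈_ _≤_ _∨_ _∧_
    ⋁-upper : ∀ {I : Set ι} (f : I → A) i → f i ≤ ⋁ f
    ⋁-least : ∀ {I : Set ι} (f : I → A) z → (∀ i → f i ≤ z) → ⋁ f ≤ z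
    ⋀-lower : ∀ {I : Set ι} (f : I → A) i → ⋀ f ≤ f i
    ⋀-greatest : ∀ {I : Set ι} (f : I → A) z → (∀ i → z ≤ f i) → z ≤ ⋀ f
    ∙-cong : ∀ {x x′ y y′} → x ≈ x′ → y ≈ y′ → (x ∙ y) ≈ (x′ ∙ y′)
    ∙-assoc : ∀ x y z → ((x ∙ y) ∙ z) ≈ (x ∙ (y ∙ z))
    ∙-distribˡ-⋁ : ∀ {I : Set ι} x (f : I → A) → (x ∙ ⋁ f) ≈ ⋁ (λ i → x ∙ f i)
    ∙-distribʳ-⋁ : ∀ {I : Set ι} x (f : I → A) → (⋁ f ∙ x) ≈ ⋁ (λ i → f i ∙ x)

record IsDistributive {c ℓ₁} (ι : Level) (A : Set c) (_≈_ : Rel A ℓ₁)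
  (⋁ ⋀ : {I : Set ι} → (I → A) → A) (_∨_ _∧_ : A → A → A)
  : Set (suc ι ⊔ c ⊔ ℓ₁) where
  field
    ∧-distribˡ-⋁ : ∀ {I : Set ι} x (f : I → A) → (x ∧ ⋁ f) ≈ ⋁ (λ i → x ∧ f i)
    ∨-distribˡ-⋀ : ∀ {I : Set ι} x (f : I → A) → (x ∨ ⋀ f) ≈ ⋀ (λ i → x ∨ f i)

record IsUnit {c ℓ₁} (A : Set c) (_≈_ : Rel A ℓ₁) (_∙_ : A → A → A) (one : A)
  : Set (c ⊔ ℓ₁) where
  field
    identityˡ : ∀ x → (one ∙ x) ≈ x
    identityʳ : ∀ x → (x ∙ one) ≈ x

Commutative : ∀ {c ℓ₁} (A : Set c) (_≈_ : Rel A ℓ₁) (_∙_ : A → A → A) → Set (c ⊔ ℓ₁)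
Commutative A _≈_ _∙_ = ∀ x y → (x ∙ y) ≈ (y ∙ x)

record Quantale c ℓ₁ ℓ₂ ι : Set (suc (c ⊔ ℓ₁ ⊔ ℓ₂ ⊔ ι)) where
  infix 4 _≈_ _≤_
  field
    Carrier : Set c
    _≈_ : Rel Carrier ℓ₁
    _≤_ : Rel Carrier ℓ₂
    ⋁ ⋀ : {I : Set ι} → (I → Carrier) → Carrier
    _∨_ _∧_ _∙_ : Carrier → Carrier → Carrier
    isQuantale : IsQuantale ι Carrier _≈_ _≤_ ⋁ ⋀ _∨_ _∧_ _∙_

module FunctionSpace {c ℓ₁ ℓ₂ ι s₁} (Q : Quantale c ℓ₁ ℓ₂ ι)
  (S₁ : Set s₁) (S₂ : Set ι) (_•_ : S₂ → S₂ → Maybe S₂) where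
  private
    module Q = Quantale Q

  Fun : Set (s₁ ⊔ ι ⊔ c)
  Fun = S₁ → S₂ → Q.Carrier

  _≈ᶠ_ : Rel Fun (s₁ ⊔ ι ⊔ ℓ₁)
  F ≈ᶠ G = ∀ x y → F x y Q.≈ G x y

  _≤ᶠ_ : Rel Fun (s₁ ⊔ ι ⊔ ℓ₂)
  F ≤ᶠ G = ∀ x y → F x y Q.≤ G x y

  ⋁ᶠ : {I : Set ι} → (I → Fun) → Fun
  ⋁ᶠ 𝔽 x y = Q.⋁ (λ i → 𝔽 i x y)

  ⋀ᶠ : {I : Set ι} → (I → Fun) → Fun
  ⋀ᶠ 𝔽 x y = Q.⋀ (λ i → 𝔽 i x y)

  _∨ᶠ_ : Fun → Fun → Fun
  (F ∨ᶠ G) x y = F x y Q.∨ G x y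

  _∧ᶠ_ : Fun → Fun → Fun
  (F ∧ᶠ G) x y = F x y Q.∧ G x y

  _∙ᶠ_ : Fun → Fun → Fun
  (F ∙ᶠ G) x y =
    Q.⋁ {I = Σ (S₂ × S₂) (λ { (y₁ , y₂) → y₁ • y₂ ≡ just y })}
        (λ { ((y₁ , y₂) , _) → F x y₁ Q.∙ G x y₂ })

  -- unit 𝟙 x y = 1 if y = e, 0 otherwise; rendered as the supremum of the
  -- family constantly 1 indexed by the proposition (y ≡ e)
  -- (classically: 1 if y = e, ⋁ ∅ = 0 otherwise).
  𝟙ᶠ : S₂ → Q.Carrier → Fun
  𝟙ᶠ e one x y = Q.⋁ {I = y ≡ e} (λ _ → one)

module Submission where

-- Order, equality, suprema, infima and binary lattice operations on
-- Fun = S₁ → S₂ → Q are pointwise, so the lattice, completeness and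
-- distributivity laws are inherited pointwise from Q.  Everything about the
-- convolution  (F ∙ G) x y = ⋁_{y = a • b} F x a ∙ G x b  is derived from two
-- facts about it: each summand lies below it (conv-upper), and it is the
-- least such bound (conv-least).  Together with the observation that in a
-- quantale  u ∙ (⋁ f)  is the supremum of the  u ∙ f i  (and dually), the
-- laws reduce to reindexing decompositions of y:
--   * associativity: a decomposition ((c • d) • b) can be rebracketed as
--     (c • (d • b)) and vice versa, by associativity of the partial semigroup;
--   * distributivity over ⋁: exchange of two suprema;
--   * units: the only decompositions involving e are e • y and y • e;
--   * commutativity: swapping a decomposition a • b into b • a.

open import Defs
open import Data.Product using (_×_; Σ; _,_)
open import Data.Maybe using (Maybe; just; nothing)
open import Data.Maybe.Properties using (just-injective)
open import Relation.Binary.PropositionalEquality using (_≡_; refl; sym; trans)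
open import Relation.Binary.Bundles using (Poset)
open import Relation.Binary.Structures using (IsPartialOrder; IsEquivalence)
open import Relation.Binary.Lattice.Structures using (IsLattice)
import Relation.Binary.Reasoning.PartialOrder as PosetReasoning

module Rebracketing {s} {S : Set s} {_•_ : S → S → Maybe S}
  (psg : IsPartialSemigroup S _•_) where
  open IsPartialSemigroup psg

  rebracketʳ : ∀ {a b c d y} → c • d ≡ just a → a • b ≡ just y →
               Σ S λ w → d • b ≡ just w × c • w ≡ just y
  rebracketʳ {a} {b} {c} {d} cd≡a ab≡y with c • d | d • b | assoc c d b
  rebracketʳ refl ab≡y | just _ | just w  | eq = w , refl , trans (sym eq) ab≡y
  rebracketʳ refl ab≡y | just _ | nothing | eq with () ← trans (sym ab≡y) eq

  rebracketˡ : ∀ {b c d w y} → d • b ≡ just w → c • w ≡ just y →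
               Σ S λ a → c • d ≡ just a × a • b ≡ just y
  rebracketˡ {b} {c} {d} db≡w cw≡y with d • b | c • d | assoc c d b
  rebracketˡ refl cw≡y | just _ | just a  | eq = a , refl , trans eq cw≡y
  rebracketˡ refl cw≡y | just _ | nothing | eq with () ← trans eq cw≡y

module QuantaleFacts {c ℓ₁ ℓ₂ ι} (Q : Quantale c ℓ₁ ℓ₂ ι) where
  open Quantale Q public
  open IsQuantale isQuantale public
  open IsLattice isLattice public
    using (isPartialOrder; x≤x∨y; y≤x∨y; ∨-least; x∧y≤x; x∧y≤y; ∧-greatest)
  open IsPartialOrder isPartialOrder public
    using (reflexive; antisym) renaming (trans to ≤-trans)
  module ≈ = IsEquivalence (IsPartialOrder.isEquivalence isPartialOrder)

  poset : Poset c ℓ₁ ℓ₂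
  poset = record { Carrier = Carrier ; _≈_ = _≈_ ; _≤_ = _≤_
                 ; isPartialOrder = isPartialOrder }

  open PosetReasoning poset public

  ⋁-mono : ∀ {I J : Set ι} (f : I → Carrier) (g : J → Carrier) →
           (∀ i → Σ J λ j → f i ≤ g j) → ⋁ f ≤ ⋁ g
  ⋁-mono f g below = ⋁-least f (⋁ g) λ i →
    let (j , fi≤gj) = below i in begin f i ≤⟨ fi≤gj ⟩ g j ≤⟨ ⋁-upper g j ⟩ ⋁ g ∎

  ⋁-cong : ∀ {I : Set ι} (f g : I → Carrier) → (∀ i → f i ≈ g i) → ⋁ f ≈ ⋁ g
  ⋁-cong f g f≈g = antisym (⋁-mono f g λ i → i , reflexive (f≈g i))
                           (⋁-mono g f λ i → i , reflexive (≈.sym (f≈g i)))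

  ∙-upperˡ : ∀ {I : Set ι} (f : I → Carrier) u i → f i ∙ u ≤ ⋁ f ∙ u
  ∙-upperˡ f u i = begin
    f i ∙ u               ≤⟨ ⋁-upper (λ j → f j ∙ u) i ⟩
    ⋁ (λ j → f j ∙ u)     ≈⟨ ≈.sym (∙-distribʳ-⋁ u f) ⟩
    ⋁ f ∙ u               ∎

  ∙-upperʳ : ∀ {I : Set ι} u (f : I → Carrier) i → u ∙ f i ≤ u ∙ ⋁ f
  ∙-upperʳ u f i = begin
    u ∙ f i               ≤⟨ ⋁-upper (λ j → u ∙ f j) i ⟩
    ⋁ (λ j → u ∙ f j)     ≈⟨ ≈.sym (∙-distribˡ-⋁ u f) ⟩
    u ∙ ⋁ f               ∎

  ∙-leastˡ : ∀ {I : Set ι} (f : I → Carrier) u z → (∀ i → f i ∙ u ≤ z) → ⋁ f ∙ u ≤ z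
  ∙-leastˡ f u z bound = begin
    ⋁ f ∙ u               ≈⟨ ∙-distribʳ-⋁ u f ⟩
    ⋁ (λ i → f i ∙ u)     ≤⟨ ⋁-least _ z bound ⟩
    z                     ∎

  ∙-leastʳ : ∀ {I : Set ι} u (f : I → Carrier) z → (∀ i → u ∙ f i ≤ z) → u ∙ ⋁ f ≤ z
  ∙-leastʳ u f z bound = begin
    u ∙ ⋁ f               ≈⟨ ∙-distribˡ-⋁ u f ⟩
    ⋁ (λ i → u ∙ f i)     ≤⟨ ⋁-least _ z bound ⟩
    z                     ∎

module Convolution {c ℓ₁ ℓ₂ ι s₁} (Q : Quantale c ℓ₁ ℓ₂ ι) (S₁ : Set s₁)
  (S₂ : Set ι) (_•_ : S₂ → S₂ → Maybe S₂) where
  open QuantaleFacts Q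
  open FunctionSpace Q S₁ S₂ _•_

  pointwiseLattice : IsLattice _≈ᶠ_ _≤ᶠ_ _∨ᶠ_ _∧ᶠ_
  pointwiseLattice = record
    { isPartialOrder = record
      { isPreorder = record
        { isEquivalence = record
          { refl  = λ x y → ≈.refl
          ; sym   = λ F≈G x y → ≈.sym (F≈G x y)
          ; trans = λ F≈G G≈H x y → ≈.trans (F≈G x y) (G≈H x y) }
        ; reflexive = λ F≈G x y → reflexive (F≈G x y)
        ; trans     = λ F≤G G≤H x y → ≤-trans (F≤G x y) (G≤H x y) }
      ; antisym = λ F≤G G≤F x y → antisym (F≤G x y) (G≤F x y) }
    ; supremum = λ F G → (λ x y → x≤x∨y (F x y) (G x y))
                       , (λ x y → y≤x∨y (F x y) (G x y))
                       , λ H F≤H G≤H x y → ∨-least (F≤H x y) (G≤H x y)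
    ; infimum  = λ F G → (λ x y → x∧y≤x (F x y) (G x y))
                       , (λ x y → x∧y≤y (F x y) (G x y))
                       , λ H H≤F H≤G x y → ∧-greatest (H≤F x y) (H≤G x y)
    }

  conv-upper : ∀ F G x {a b y} → a • b ≡ just y → F x a ∙ G x b ≤ (F ∙ᶠ G) x y
  conv-upper F G x {a} {b} ab≡y =
    ⋁-upper (λ { ((a′ , b′) , _) → F x a′ ∙ G x b′ }) ((a , b) , ab≡y)

  conv-least : ∀ F G x y z → (∀ a b → a • b ≡ just y → F x a ∙ G x b ≤ z) →
               (F ∙ᶠ G) x y ≤ z
  conv-least F G x y z bound = ⋁-least _ z λ { ((a , b) , ab≡y) → bound a b ab≡y }

  conv-cong : ∀ {F F′ G G′} → F ≈ᶠ F′ → G ≈ᶠ G′ → (F ∙ᶠ G) ≈ᶠ (F′ ∙ᶠ G′)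
  conv-cong F≈F′ G≈G′ x y = ⋁-cong _ _ λ { ((a , b) , _) → ∙-cong (F≈F′ x a) (G≈G′ x b) }

  conv-distribˡ-⋁ : ∀ {I : Set ι} F (𝔾 : I → Fun) →
                    (F ∙ᶠ ⋁ᶠ 𝔾) ≈ᶠ ⋁ᶠ (λ i → F ∙ᶠ 𝔾 i)
  conv-distribˡ-⋁ F 𝔾 x y = antisym
    (conv-least F (⋁ᶠ 𝔾) x y _ λ a b ab≡y →
      ∙-leastʳ (F x a) (λ i → 𝔾 i x b) _ λ i → begin
        F x a ∙ 𝔾 i x b                 ≤⟨ conv-upper F (𝔾 i) x ab≡y ⟩
        (F ∙ᶠ 𝔾 i) x y                  ≤⟨ ⋁-upper (λ j → (F ∙ᶠ 𝔾 j) x y) i ⟩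
        ⋁ᶠ (λ j → F ∙ᶠ 𝔾 j) x y         ∎)
    (⋁-least _ _ λ i → conv-least F (𝔾 i) x y _ λ a b ab≡y → begin
        F x a ∙ 𝔾 i x b                 ≤⟨ ∙-upperʳ (F x a) (λ j → 𝔾 j x b) i ⟩
        F x a ∙ ⋁ᶠ 𝔾 x b                ≤⟨ conv-upper F (⋁ᶠ 𝔾) x ab≡y ⟩
        (F ∙ᶠ ⋁ᶠ 𝔾) x y                 ∎)

  conv-distribʳ-⋁ : ∀ {I : Set ι} F (𝔾 : I → Fun) →
                    (⋁ᶠ 𝔾 ∙ᶠ F) ≈ᶠ ⋁ᶠ (λ i → 𝔾 i ∙ᶠ F)
  conv-distribʳ-⋁ F 𝔾 x y = antisym
    (conv-least (⋁ᶠ 𝔾) F x y _ λ a b ab≡y →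
      ∙-leastˡ (λ i → 𝔾 i x a) (F x b) _ λ i → begin
        𝔾 i x a ∙ F x b                 ≤⟨ conv-upper (𝔾 i) F x ab≡y ⟩
        (𝔾 i ∙ᶠ F) x y                  ≤⟨ ⋁-upper (λ j → (𝔾 j ∙ᶠ F) x y) i ⟩
        ⋁ᶠ (λ j → 𝔾 j ∙ᶠ F) x y         ∎)
    (⋁-least _ _ λ i → conv-least (𝔾 i) F x y _ λ a b ab≡y → begin
        𝔾 i x a ∙ F x b                 ≤⟨ ∙-upperˡ (λ j → 𝔾 j x a) (F x b) i ⟩
        ⋁ᶠ 𝔾 x a ∙ F x b                ≤⟨ conv-upper (⋁ᶠ 𝔾) F x ab≡y ⟩
        (⋁ᶠ 𝔾 ∙ᶠ F) x y                 ∎)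

  -- Associativity, one inequality at a time; each term of one bracketing is
  -- matched with a term of the other via rebracketing in S₂.
  module Associativity (psg : IsPartialSemigroup S₂ _•_) where
    open Rebracketing psg

    conv-assoc-≤ : ∀ F G H x y → ((F ∙ᶠ G) ∙ᶠ H) x y ≤ (F ∙ᶠ (G ∙ᶠ H)) x y
    conv-assoc-≤ F G H x y = conv-least (F ∙ᶠ G) H x y _ λ a b ab≡y →
      ∙-leastˡ _ (H x b) _ λ { ((c , d) , cd≡a) →
        let (w , db≡w , cw≡y) = rebracketʳ cd≡a ab≡y in begin
          (F x c ∙ G x d) ∙ H x b       ≈⟨ ∙-assoc _ _ _ ⟩
          F x c ∙ (G x d ∙ H x b)       ≤⟨ ∙-upperʳ (F x c) _ ((d , b) , db≡w) ⟩
          F x c ∙ (G ∙ᶠ H) x w          ≤⟨ conv-upper F (G ∙ᶠ H) x cw≡y ⟩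
          (F ∙ᶠ (G ∙ᶠ H)) x y           ∎ }

    conv-assoc-≥ : ∀ F G H x y → (F ∙ᶠ (G ∙ᶠ H)) x y ≤ ((F ∙ᶠ G) ∙ᶠ H) x y
    conv-assoc-≥ F G H x y = conv-least F (G ∙ᶠ H) x y _ λ c w cw≡y →
      ∙-leastʳ (F x c) _ _ λ { ((d , b) , db≡w) →
        let (a , cd≡a , ab≡y) = rebracketˡ db≡w cw≡y in begin
          F x c ∙ (G x d ∙ H x b)       ≈⟨ ≈.sym (∙-assoc _ _ _) ⟩
          (F x c ∙ G x d) ∙ H x b       ≤⟨ ∙-upperˡ _ (H x b) ((c , d) , cd≡a) ⟩
          (F ∙ᶠ G) x a ∙ H x b          ≤⟨ conv-upper (F ∙ᶠ G) H x ab≡y ⟩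
          ((F ∙ᶠ G) ∙ᶠ H) x y           ∎ }

    conv-assoc : ∀ F G H → ((F ∙ᶠ G) ∙ᶠ H) ≈ᶠ (F ∙ᶠ (G ∙ᶠ H))
    conv-assoc F G H x y = antisym (conv-assoc-≤ F G H x y) (conv-assoc-≥ F G H x y)

  quantale : IsPartialSemigroup S₂ _•_ → IsQuantale ι Fun _≈ᶠ_ _≤ᶠ_ ⋁ᶠ ⋀ᶠ _∨ᶠ_ _∧ᶠ_ _∙ᶠ_
  quantale psg = record
    { isLattice    = pointwiseLattice
    ; ⋁-upper      = λ 𝔽 i x y → ⋁-upper (λ j → 𝔽 j x y) i
    ; ⋁-least      = λ 𝔽 Z bound x y → ⋁-least (λ i → 𝔽 i x y) (Z x y) λ i → bound i x y
    ; ⋀-lower      = λ 𝔽 i x y → ⋀-lower (λ j → 𝔽 j x y) i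
    ; ⋀-greatest   = λ 𝔽 Z bound x y → ⋀-greatest (λ i → 𝔽 i x y) (Z x y) λ i → bound i x y
    ; ∙-cong       = conv-cong
    ; ∙-assoc      = Associativity.conv-assoc psg
    ; ∙-distribˡ-⋁ = conv-distribˡ-⋁
    ; ∙-distribʳ-⋁ = conv-distribʳ-⋁
    }

  distributive : IsDistributive ι Carrier _≈_ ⋁ ⋀ _∨_ _∧_ →
                 IsDistributive ι Fun _≈ᶠ_ ⋁ᶠ ⋀ᶠ _∨ᶠ_ _∧ᶠ_
  distributive dist = record
    { ∧-distribˡ-⋁ = λ F 𝔾 x y → D.∧-distribˡ-⋁ (F x y) (λ i → 𝔾 i x y)
    ; ∨-distribˡ-⋀ = λ F 𝔾 x y → D.∨-distribˡ-⋀ (F x y) (λ i → 𝔾 i x y) }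
    where module D = IsDistributive dist

  -- 𝟙ᶠ e one is a unit: its only nonzero value one sits at e, and e • y and
  -- y • e are the only decompositions of y involving e.
  unit : ∀ e one → IsPartialMonoid S₂ _•_ e → IsUnit Carrier _≈_ _∙_ one →
         IsUnit Fun _≈ᶠ_ _∙ᶠ_ (𝟙ᶠ e one)
  unit e one monoid unitQ = record
    { identityˡ = λ F x y → antisym (unit-leftˡ F x y) (unit-leftʳ F x y)
    ; identityʳ = λ F x y → antisym (unit-rightˡ F x y) (unit-rightʳ F x y) }
    where
      module M = IsPartialMonoid monoid
      module U = IsUnit unitQ

      value-cong : ∀ (F : Fun) x {b y} → b ≡ y → F x b ≈ F x y
      value-cong F x refl = ≈.refl

      unit-leftˡ : ∀ F x y → (𝟙ᶠ e one ∙ᶠ F) x y ≤ F x y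
      unit-leftˡ F x y = conv-least (𝟙ᶠ e one) F x y _ λ a b ab≡y →
        ∙-leastˡ _ (F x b) _ λ { refl → begin
          one ∙ F x b     ≈⟨ U.identityˡ (F x b) ⟩
          F x b           ≈⟨ value-cong F x (just-injective (trans (sym (M.identityˡ b)) ab≡y)) ⟩
          F x y           ∎ }

      unit-leftʳ : ∀ F x y → F x y ≤ (𝟙ᶠ e one ∙ᶠ F) x y
      unit-leftʳ F x y = begin
        F x y                     ≈⟨ ≈.sym (U.identityˡ (F x y)) ⟩
        one ∙ F x y               ≤⟨ ∙-upperˡ (λ _ → one) (F x y) refl ⟩
        𝟙ᶠ e one x e ∙ F x y      ≤⟨ conv-upper (𝟙ᶠ e one) F x (M.identityˡ y) ⟩
        (𝟙ᶠ e one ∙ᶠ F) x y       ∎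

      unit-rightˡ : ∀ F x y → (F ∙ᶠ 𝟙ᶠ e one) x y ≤ F x y
      unit-rightˡ F x y = conv-least F (𝟙ᶠ e one) x y _ λ a b ab≡y →
        ∙-leastʳ (F x a) _ _ λ { refl → begin
          F x a ∙ one     ≈⟨ U.identityʳ (F x a) ⟩
          F x a           ≈⟨ value-cong F x (just-injective (trans (sym (M.identityʳ a)) ab≡y)) ⟩
          F x y           ∎ }

      unit-rightʳ : ∀ F x y → F x y ≤ (F ∙ᶠ 𝟙ᶠ e one) x y
      unit-rightʳ F x y = begin
        F x y                     ≈⟨ ≈.sym (U.identityʳ (F x y)) ⟩
        F x y ∙ one               ≤⟨ ∙-upperʳ (F x y) (λ _ → one) refl ⟩
        F x y ∙ 𝟙ᶠ e one x e      ≤⟨ conv-upper F (𝟙ᶠ e one) x (M.identityʳ y) ⟩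
        (F ∙ᶠ 𝟙ᶠ e one) x y       ∎

  commutative : PartialCommutative S₂ _•_ → Commutative Carrier _≈_ _∙_ →
                Commutative Fun _≈ᶠ_ _∙ᶠ_
  commutative •-comm ∙-comm F G x y = antisym (swap F G) (swap G F)
    where
      swap : ∀ F G → (F ∙ᶠ G) x y ≤ (G ∙ᶠ F) x y
      swap F G = conv-least F G x y _ λ a b ab≡y → begin
        F x a ∙ G x b     ≈⟨ ∙-comm (F x a) (G x b) ⟩
        G x b ∙ F x a     ≤⟨ conv-upper G F x (trans (•-comm b a) ab≡y) ⟩
        (G ∙ᶠ F) x y      ∎

corollary10p4 :
    ∀ {c ℓ₁ ℓ₂ ι s₁} (Q : Quantale c ℓ₁ ℓ₂ ι) (S₁ : Set s₁) (S₂ : Set ι)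
      (_•_ : S₂ → S₂ → Maybe S₂) → IsPartialSemigroup S₂ _•_ →
      let open Quantale Q
          open FunctionSpace Q S₁ S₂ _•_
      in IsQuantale ι Fun _≈ᶠ_ _≤ᶠ_ ⋁ᶠ ⋀ᶠ _∨ᶠ_ _∧ᶠ_ _∙ᶠ_
         × (IsDistributive ι Carrier _≈_ ⋁ ⋀ _∨_ _∧_ →
            IsDistributive ι Fun _≈ᶠ_ ⋁ᶠ ⋀ᶠ _∨ᶠ_ _∧ᶠ_)
         × (∀ (e : S₂) (one : Carrier) → IsPartialMonoid S₂ _•_ e →
            IsUnit Carrier _≈_ _∙_ one → IsUnit Fun _≈ᶠ_ _∙ᶠ_ (𝟙ᶠ e one))
         × (PartialCommutative S₂ _•_ → Commutative Carrier _≈_ _∙_ →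
            Commutative Fun _≈ᶠ_ _∙ᶠ_)
corollary10p4 Q S₁ S₂ _•_ psg = quantale psg , distributive , unit , commutative
  where open Convolution Q S₁ S₂ _•_
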